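{- Let $H$ be a hole in a proper Helly circular-arc graph $G$. Then every vertex of $G$ has at least two neighbors on $H$.
   Context: A hole is an induced cycle of length at least four. An arc representation assigns closed arcs on a circle to vertices so that adjacency equals arc intersection; it is proper if no arc properly contains another and Helly if every family of pairwise intersecting arcs has a common point. A proper Helly circular-arc graph has an arc representation that is both proper and Helly. -}

module Defs where

open import Data.Nat using (ℕ; zero; suc; _+_; _∸_; _≤_; _<_)
open import Data.Nat.DivMod using (_%_)
open import Data.Fin using (Fin; toℕ)
open import Data.Product using (Σ; _×_; ∃; ∃-syntax; _,_)
open import Data.List using (List)
open import Data.Sum using (_⊎_)
open import Data.List.Membership.Propositional using (_∈_)
open import Relation.Binary.PropositionalEquality using (_≡_; _≢_)
open import Relation.Nullary using (¬_)
open import Function.Bundles using (_⇔_)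
open import Function.Definitions using (Injective)

-- Circle: the discrete circle with (suc k) points, Fin (suc k), in cyclic
-- order 0,1,...,k,0.  (For finitely many arcs only the cyclic order of the
-- endpoints matters, so this loses no generality.)

-- A closed arc: starts at `start` and proceeds clockwise over `len`
-- further points, covering start, start+1, ..., start+len (mod suc k).
record Arc (k : ℕ) : Set where
  constructor arc
  field
    start : Fin (suc k)
    len   : ℕ
    len≤  : len ≤ k

open Arc public

cwDist : {k : ℕ} → Fin (suc k) → Fin (suc k) → ℕ
cwDist {k} s p = (toℕ p + (suc k ∸ toℕ s)) % suc k

_∈Arc_ : {k : ℕ} → Fin (suc k) → Arc k → Set
p ∈Arc a = cwDist (start a) p ≤ len a

_⊆Arc_ : {k : ℕ} → Arc k → Arc k → Set
a ⊆Arc b = ∀ p → p ∈Arc a → p ∈Arc b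

Intersect : {k : ℕ} → Arc k → Arc k → Set
Intersect a b = ∃[ p ] (p ∈Arc a × p ∈Arc b)

record SimpleGraph (n : ℕ) : Set₁ where
  field
    Adj    : Fin n → Fin n → Set
    sym    : ∀ {u v} → Adj u v → Adj v u
    irrefl : ∀ {u} → ¬ Adj u u

open SimpleGraph public

IsArcRep : {n k : ℕ} → SimpleGraph n → (Fin n → Arc k) → Set
IsArcRep G f = ∀ u v → u ≢ v → (Adj G u v ⇔ Intersect (f u) (f v))

IsProper : {n k : ℕ} → (Fin n → Arc k) → Set
IsProper f = ∀ u v → ¬ ((f u ⊆Arc f v) × ¬ (f v ⊆Arc f u))

IsHelly : {n k : ℕ} → (Fin n → Arc k) → Set
IsHelly {n} f = ∀ (S : List (Fin n)) →
  (∀ u v → u ∈ S → v ∈ S → Intersect (f u) (f v)) →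
  ∃[ p ] (∀ u → u ∈ S → p ∈Arc f u)

IsPHCA : {n : ℕ} → SimpleGraph n → Set
IsPHCA {n} G = ∃[ k ] Σ (Fin n → Arc k) λ f →
  IsArcRep G f × IsProper f × IsHelly f

CycAdj : {L : ℕ} → Fin L → Fin L → Set
CycAdj {L} i j = Succ i j ⊎ Succ j i
  where
  Succ : Fin L → Fin L → Set
  Succ a b = (toℕ b ≡ suc (toℕ a)) ⊎ ((suc (toℕ a) ≡ L) × (toℕ b ≡ 0))

record Hole {n : ℕ} (G : SimpleGraph n) : Set where
  field
    L       : ℕ
    4≤L     : 4 ≤ L
    vert    : Fin L → Fin n
    inj     : Injective _≡_ _≡_ vert
    induced : ∀ i j → (Adj G (vert i) (vert j) ⇔ CycAdj i j)

open Hole public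

HasTwoNeighboursOn : {n : ℕ} (G : SimpleGraph n) → Hole G → Fin n → Set
HasTwoNeighboursOn G H v =
  ∃[ i ] ∃[ j ] (i ≢ j × Adj G v (vert H i) × Adj G v (vert H j))

{-# OPTIONS --safe #-}
module Submission where

-- The arcs of a hole cover the circle. Otherwise, cut the circle at an
-- uncovered point, so that these arcs become intervals, and take the arc a
-- of the hole that ends first. Its two neighbours on the hole both meet a
-- and end no earlier than a, so whichever meets a further to the right
-- meets the other one there; since the hole has length at least 4, these
-- two neighbours are not adjacent, a contradiction.
-- A vertex on the hole has its two hole neighbours. The arc of a vertex off
-- the hole that meets at most one hole arc a is, by the covering, contained
-- in a, and strictly so because a meets a further hole arc outside it; this
-- contradicts properness.

open import Defs hiding (sym)
open import Data.Empty using (⊥-elim)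
open import Data.Fin using (Fin; toℕ; fromℕ<) renaming (_≟_ to _≟ᶠ_)
open import Data.Fin.Properties using (any?; toℕ<n; toℕ-fromℕ<; fromℕ<-injective)
open import Data.List using (allFin)
open import Data.List.Extrema.Nat using (argmin; f[argmin]≤f[xs])
open import Data.List.Membership.Propositional.Properties using (∈-allFin)
import Data.List.Relation.Unary.All as All
open import Data.Nat using (ℕ; zero; suc; _+_; _∸_; _≤_; _<_; z≤n; s≤s; z<s; _≤?_; _<?_; NonZero)
open import Data.Nat.DivMod using (_%_; m%n<n; n%n≡0; m<n⇒m%n≡m; m≤n⇒[n∸m]%m≡n%m; [m+n]%n≡m%n; %-distribˡ-+)
open import Data.Nat.Properties
open import Data.Nat.Tactic.RingSolver using (solve-∀)
open import Data.Product using (_×_; _,_; proj₁; proj₂; ∃₂; ∃-syntax; curry)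
open import Data.Sum using (_⊎_; inj₁; inj₂; [_,_]′) renaming (swap to ⊎-swap)
open import Function using (_∘_)
open import Function.Bundles using (_⇔_; Equivalence)
open import Function.Construct.Composition using (_⇔-∘_)
open import Function.Construct.Symmetry using (⇔-sym)
open import Relation.Nullary using (¬_; Dec; yes; no; contradiction)
open import Relation.Nullary.Decidable using (decidable-stable; _×-dec_; ¬?)
open import Relation.Binary.PropositionalEquality

private
  variable
    k m : ℕ

+-%-cases : ∀ {a b N} .{{_ : NonZero N}} → a < N → b < N →
  a + b ≡ (a + b) % N ⊎ a + b ≡ (a + b) % N + N
+-%-cases {a} {b} {N} a<N b<N with a + b <? N
... | yes a+b<N = inj₁ (sym (m<n⇒m%n≡m a+b<N))
... | no a+b≮N = inj₂ (begin
    a + b                ≡⟨ sym (m∸n+n≡m N≤a+b) ⟩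
    (a + b ∸ N) + N      ≡⟨ cong (_+ N) (sym (m<n⇒m%n≡m a+b∸N<N)) ⟩
    (a + b ∸ N) % N + N  ≡⟨ cong (_+ N) (m≤n⇒[n∸m]%m≡n%m N≤a+b) ⟩
    (a + b) % N + N      ∎)
  where
  open ≡-Reasoning
  N≤a+b : N ≤ a + b
  N≤a+b = ≮⇒≥ a+b≮N
  a+b∸N<N : a + b ∸ N < N
  a+b∸N<N = m<n+o⇒m∸n<o (a + b) N (+-mono-< a<N b<N)

cwDist<N : (s x : Fin (suc k)) → cwDist s x < suc k
cwDist<N {k} s x = m%n<n (toℕ x + (suc k ∸ toℕ s)) (suc k)

cwDist-self : (s : Fin (suc k)) → cwDist s s ≡ 0
cwDist-self {k} s = trans (cong (_% suc k) (m+[n∸m]≡n (<⇒≤ (toℕ<n s)))) (n%n≡0 (suc k))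

cwDist-additive : (q s x : Fin (suc k)) → (cwDist q s + cwDist s x) % suc k ≡ cwDist q x
cwDist-additive {k} q s x = begin
  (cwDist q s + cwDist s x) % N      ≡⟨ sym (%-distribˡ-+ (s′ + N∸q) (x′ + N∸s) N) ⟩
  ((s′ + N∸q) + (x′ + N∸s)) % N      ≡⟨ cong (_% N) (exchange s′ N∸q x′ N∸s) ⟩
  ((x′ + N∸q) + (s′ + N∸s)) % N      ≡⟨ cong (λ r → ((x′ + N∸q) + r) % N) (m+[n∸m]≡n (<⇒≤ (toℕ<n s))) ⟩
  ((x′ + N∸q) + N) % N               ≡⟨ [m+n]%n≡m%n (x′ + N∸q) N ⟩
  cwDist q x                         ∎
  where
  open ≡-Reasoning
  N = suc k
  s′ = toℕ s
  x′ = toℕ x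
  N∸q = N ∸ toℕ q
  N∸s = N ∸ toℕ s
  exchange : ∀ a b c d → (a + b) + (c + d) ≡ (c + b) + (a + d)
  exchange = solve-∀

cwDist-split : (q s x : Fin (suc k)) →
  cwDist q s + cwDist s x ≡ cwDist q x ⊎ cwDist q s + cwDist s x ≡ cwDist q x + suc k
cwDist-split {k} q s x =
  subst (λ r → cwDist q s + cwDist s x ≡ r ⊎ cwDist q s + cwDist s x ≡ r + suc k)
        (cwDist-additive q s x)
        (+-%-cases (cwDist<N q s) (cwDist<N s x))

start∈Arc : (a : Arc k) → start a ∈Arc a
start∈Arc a = subst (_≤ len a) (sym (cwDist-self (start a))) z≤n

_∈Arc?_ : (p : Fin (suc k)) (a : Arc k) → Dec (p ∈Arc a)
p ∈Arc? a = cwDist (start a) p ≤? len a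

intersect? : (a b : Arc k) → Dec (Intersect a b)
intersect? a b = any? (λ p → (p ∈Arc? a) ×-dec (p ∈Arc? b))

-- Reading positions clockwise from a point q, an arc avoiding q is the
-- interval [left a, right a] of positions.
module CutAt (q : Fin (suc k)) where

  pos : Fin (suc k) → ℕ
  pos = cwDist q

  left right : Arc k → ℕ
  left a = pos (start a)
  right a = left a + len a

  right<N : (a : Arc k) → ¬ q ∈Arc a → right a < suc k
  right<N a q∉a with cwDist-split q (start a) q
  ... | inj₁ e = contradiction
      (subst (_≤ len a) (sym (m+n≡0⇒n≡0 (left a) (trans e (cwDist-self q)))) z≤n) q∉a
  ... | inj₂ e = subst (right a <_) (trans e (cong (_+ suc k) (cwDist-self q)))
      (+-monoʳ-< (left a) (≰⇒> q∉a))

  ∈Arc⇒between : (a : Arc k) (x : Fin (suc k)) → ¬ q ∈Arc a → x ∈Arc a →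
    left a ≤ pos x × pos x ≤ right a
  ∈Arc⇒between a x q∉a x∈a with cwDist-split q (start a) x
  ... | inj₁ e = subst (left a ≤_) e (m≤m+n _ _) , subst (_≤ right a) e (+-monoʳ-≤ (left a) x∈a)
  ... | inj₂ e = contradiction (right<N a q∉a) (≤⇒≯ (begin
      suc k                          ≤⟨ m≤n+m (suc k) (pos x) ⟩
      pos x + suc k                  ≡⟨ sym e ⟩
      left a + cwDist (start a) x    ≤⟨ +-monoʳ-≤ (left a) x∈a ⟩
      right a                        ∎))
    where open ≤-Reasoning hiding (start)

  between⇒∈Arc : (a : Arc k) (x : Fin (suc k)) → left a ≤ pos x → pos x ≤ right a → x ∈Arc a
  between⇒∈Arc a x l≤x x≤r with cwDist-split q (start a) x
  ... | inj₁ e = +-cancelˡ-≤ (left a) _ _ (subst (_≤ right a) (sym e) x≤r)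
  ... | inj₂ e = contradiction l≤x (<⇒≱ (+-cancelʳ-< (suc k) (pos x) (left a)
                   (subst (_< left a + suc k) e (+-monoʳ-< (left a) (cwDist<N (start a) x)))))

  ∈Arc-beyond : ∀ a b x y → ¬ q ∈Arc a → ¬ q ∈Arc b → right a ≤ right b →
    x ∈Arc b → y ∈Arc a → pos x ≤ pos y → y ∈Arc b
  ∈Arc-beyond a b x y q∉a q∉b ra≤rb x∈b y∈a x≤y =
    between⇒∈Arc b y (≤-trans (proj₁ (∈Arc⇒between b x q∉b x∈b)) x≤y)
                   (≤-trans (proj₂ (∈Arc⇒between a y q∉a y∈a)) ra≤rb)

  intersect-through-first-ending : ∀ a b c → ¬ q ∈Arc a → ¬ q ∈Arc b → ¬ q ∈Arc c →
    right a ≤ right b → right a ≤ right c →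
    Intersect b a → Intersect a c → Intersect b c
  intersect-through-first-ending a b c q∉a q∉b q∉c ra≤rb ra≤rc (x , x∈b , x∈a) (y , y∈a , y∈c)
    with ≤-total (pos x) (pos y)
  ... | inj₁ x≤y = y , ∈Arc-beyond a b x y q∉a q∉b ra≤rb x∈b y∈a x≤y , y∈c
  ... | inj₂ y≤x = x , x∈b , ∈Arc-beyond a c y x q∉a q∉c ra≤rc y∈c x∈a y≤x

-- For i j : Fin m, CycAdj i j unfolds to CycAdjℕ m (toℕ i) (toℕ j).
CycSuccℕ : ℕ → ℕ → ℕ → Set
CycSuccℕ m a b = b ≡ suc a ⊎ (suc a ≡ m × b ≡ 0)

CycAdjℕ : ℕ → ℕ → ℕ → Set
CycAdjℕ m a b = CycSuccℕ m a b ⊎ CycSuccℕ m b a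

CycSuccℕ-irrefl : 2 ≤ m → ∀ {a} → ¬ CycSuccℕ m a a
CycSuccℕ-irrefl _   (inj₁ a≡1+a)        = 1+n≢n (sym a≡1+a)
CycSuccℕ-irrefl 2≤m (inj₂ (1≡m , refl)) = <⇒≢ 2≤m 1≡m

CycAdj⇒≢ : 2 ≤ m → {i j : Fin m} → CycAdj i j → i ≢ j
CycAdj⇒≢ 2≤m i~j refl = [ CycSuccℕ-irrefl 2≤m , CycSuccℕ-irrefl 2≤m ]′ i~j

CycAdj-sym : {i j : Fin m} → CycAdj i j → CycAdj j i
CycAdj-sym = ⊎-swap

cycle-neighboursℕ : 4 ≤ m → ∀ {t} → t < m → ∃₂ λ p s →
  p < m × s < m × CycAdjℕ m p t × CycAdjℕ m t s × p ≢ s × ¬ CycAdjℕ m p s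
cycle-neighboursℕ {suc (suc (suc (suc r)))} (s≤s (s≤s (s≤s (s≤s _)))) {zero} _ =
  3 + r , 1 , ≤-refl , s≤s (s≤s z≤n) , inj₁ (inj₂ (refl , refl)) , inj₁ (inj₁ refl) , (λ ()) ,
  λ { (inj₁ (inj₁ ())) ; (inj₁ (inj₂ (_ , ()))) ; (inj₂ (inj₁ ())) ; (inj₂ (inj₂ (() , _))) }
cycle-neighboursℕ {suc (suc (suc (suc r)))} (s≤s (s≤s (s≤s (s≤s _)))) {suc u} (s≤s u<3+r)
  with m≤n⇒m<n∨m≡n u<3+r
... | inj₂ refl =
  2 + r , 0 , n≤1+n _ , z<s , inj₁ (inj₁ refl) , inj₁ (inj₂ (refl , refl)) , (λ ()) ,
  λ { (inj₁ (inj₁ ())) ; (inj₁ (inj₂ (3+r≡4+r , _))) → 1+n≢n (sym (suc-injective 3+r≡4+r))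
    ; (inj₂ (inj₁ ())) ; (inj₂ (inj₂ (() , _))) }
... | inj₁ 1+u<3+r =
  u , 2 + u , m<n⇒m<1+n u<3+r , s≤s 1+u<3+r , inj₁ (inj₁ refl) , inj₁ (inj₁ refl) ,
  <⇒≢ (m<n+m u z<s) ,
  λ { (inj₁ (inj₁ 2+u≡1+u)) → 1+n≢n 2+u≡1+u ; (inj₁ (inj₂ (_ , ())))
    ; (inj₂ (inj₁ u≡3+u)) → <⇒≢ (m<n+m u z<s) u≡3+u ; (inj₂ (inj₂ (() , refl))) }

cycle-neighbours : 4 ≤ m → (i : Fin m) → ∃₂ λ p s →
  CycAdj p i × CycAdj i s × p ≢ s × ¬ CycAdj p s
cycle-neighbours {m} 4≤m i with cycle-neighboursℕ 4≤m (toℕ<n i)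
... | p , s , p<m , s<m , p~i , i~s , p≢s , p≁s =
  fromℕ< p<m , fromℕ< s<m ,
  subst (λ p′ → CycAdjℕ m p′ (toℕ i)) (sym (toℕ-fromℕ< p<m)) p~i ,
  subst (CycAdjℕ m (toℕ i)) (sym (toℕ-fromℕ< s<m)) i~s ,
  p≢s ∘ fromℕ<-injective p s p<m s<m ,
  p≁s ∘ subst₂ (CycAdjℕ m) (toℕ-fromℕ< p<m) (toℕ-fromℕ< s<m)

minimiser : Fin m → (g : Fin m → ℕ) → ∃[ i ] ∀ j → g i ≤ g j
minimiser {m} i₀ g =
  argmin g i₀ (allFin m) , λ j → All.lookup (f[argmin]≤f[xs] i₀ (allFin m)) (∈-allFin j)

IsArcCycle : (Fin m → Arc k) → Set
IsArcCycle a = ∀ i j → i ≢ j → (Intersect (a i) (a j) ⇔ CycAdj i j)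

module ArcCycle (a : Fin m → Arc k) (4≤m : 4 ≤ m) (cycle : IsArcCycle a) where

  private
    2≤m : 2 ≤ m
    2≤m = ≤-trans (s≤s (s≤s z≤n)) 4≤m

    i₀ : Fin m
    i₀ = fromℕ< (≤-trans (s≤s z≤n) 4≤m)

  consecutive-intersect : ∀ {i j} → CycAdj i j → Intersect (a i) (a j)
  consecutive-intersect {i} {j} i~j = Equivalence.from (cycle i j (CycAdj⇒≢ 2≤m i~j)) i~j

  meets-another : ∀ i → ∃[ j ] i ≢ j × Intersect (a i) (a j)
  meets-another i with cycle-neighbours 4≤m i
  ... | _ , s , _ , i~s , _ = s , CycAdj⇒≢ 2≤m i~s , consecutive-intersect i~s

  no-gap : ∀ q → ¬ (∀ j → ¬ q ∈Arc a j)
  no-gap q q∉ with minimiser i₀ (CutAt.right q ∘ a)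
  ... | i , ends-first with cycle-neighbours 4≤m i
  ... | p , s , p~i , i~s , p≢s , p≁s =
    p≁s (Equivalence.to (cycle p s p≢s)
      (intersect-through-first-ending (a i) (a p) (a s) (q∉ i) (q∉ p) (q∉ s)
        (ends-first p) (ends-first s) (consecutive-intersect p~i) (consecutive-intersect i~s)))
    where open CutAt q

  covers : ∀ q → ∃[ j ] q ∈Arc a j
  covers q = decidable-stable (any? (λ j → q ∈Arc? a j)) (no-gap q ∘ curry)

_⊂Arc_ : Arc k → Arc k → Set
a ⊂Arc b = a ⊆Arc b × ¬ b ⊆Arc a

MeetsTwo : (b : Arc k) → (Fin m → Arc k) → Set
MeetsTwo b a = ∃₂ λ i j → i ≢ j × Intersect b (a i) × Intersect b (a j)

meetsTwo? : (b : Arc k) (a : Fin m → Arc k) → Dec (MeetsTwo b a)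
meetsTwo? b a = any? λ i → any? λ j → ¬? (i ≟ᶠ j) ×-dec intersect? b (a i) ×-dec intersect? b (a j)

module ArcCover (a : Fin m → Arc k) (covers : ∀ q → ∃[ i ] q ∈Arc a i)
                (meets-another : ∀ i → ∃[ j ] i ≢ j × Intersect (a i) (a j)) where

  ¬MeetsTwo⇒⊂Arc : (b : Arc k) → ¬ MeetsTwo b a → ∃[ i ] b ⊂Arc a i
  ¬MeetsTwo⇒⊂Arc b ¬two = i , b⊆aᵢ , aᵢ⊈b
    where
    i = proj₁ (covers (start b))

    start∈aᵢ : start b ∈Arc a i
    start∈aᵢ = proj₂ (covers (start b))

    b⊆aᵢ : b ⊆Arc a i
    b⊆aᵢ x x∈b with covers x
    ... | j , x∈aⱼ with i ≟ᶠ j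
    ... | yes refl = x∈aⱼ
    ... | no i≢j = ⊥-elim (¬two (i , j , i≢j , (start b , start∈Arc b , start∈aᵢ) , (x , x∈b , x∈aⱼ)))

    aᵢ⊈b : ¬ a i ⊆Arc b
    aᵢ⊈b aᵢ⊆b with meets-another i
    ... | j , i≢j , (x , x∈aᵢ , x∈aⱼ) =
      ¬two (i , j , i≢j , (x , aᵢ⊆b x x∈aᵢ , x∈aᵢ) , (x , aᵢ⊆b x x∈aᵢ , x∈aⱼ))

  ¬⊂Arc⇒MeetsTwo : (b : Arc k) → (∀ i → ¬ b ⊂Arc a i) → MeetsTwo b a
  ¬⊂Arc⇒MeetsTwo b not-inside = decidable-stable (meetsTwo? b a) λ ¬two →
    let i , b⊂aᵢ = ¬MeetsTwo⇒⊂Arc b ¬two in not-inside i b⊂aᵢ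

hole-vertex-has-two-neighbours : ∀ {n} {G : SimpleGraph n} (H : Hole G) (i : Fin (L H)) →
  HasTwoNeighboursOn G H (vert H i)
hole-vertex-has-two-neighbours H i with cycle-neighbours (4≤L H) i
... | p , s , p~i , i~s , p≢s , _ =
  p , s , p≢s , Equivalence.from (induced H i p) (CycAdj-sym p~i) , Equivalence.from (induced H i s) i~s

module _ {n} {G : SimpleGraph n} (f : Fin n → Arc k) (rep : IsArcRep G f) where

  hole-IsArcCycle : (H : Hole G) → IsArcCycle (f ∘ vert H)
  hole-IsArcCycle H i j i≢j =
    induced H i j ⇔-∘ ⇔-sym (rep (vert H i) (vert H j) (λ vᵢ≡vⱼ → i≢j (inj H vᵢ≡vⱼ)))

  off-hole-vertex-has-two-neighbours : IsProper f → (H : Hole G) → ∀ v → (∀ i → vert H i ≢ v) →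
    HasTwoNeighboursOn G H v
  off-hole-vertex-has-two-neighbours proper H v v∉H =
    let i , j , i≢j , v-meets-i , v-meets-j =
          ¬⊂Arc⇒MeetsTwo (f v) (λ i → proper v (vert H i))
    in i , j , i≢j , adjacent i v-meets-i , adjacent j v-meets-j
    where
    open ArcCycle (f ∘ vert H) (4≤L H) (hole-IsArcCycle H)
    open ArcCover (f ∘ vert H) covers meets-another
    adjacent : ∀ i → Intersect (f v) (f (vert H i)) → Adj G v (vert H i)
    adjacent i = Equivalence.from (rep v (vert H i) (λ v≡vᵢ → v∉H i (sym v≡vᵢ)))

proposition4p1 : {n : ℕ} (G : SimpleGraph n) → IsPHCA G →
    (H : Hole G) → (v : Fin n) → HasTwoNeighboursOn G H v
proposition4p1 G (_ , f , rep , proper , _) H v with any? (λ i → vert H i ≟ᶠ v)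
... | yes (i , refl) = hole-vertex-has-two-neighbours H i
... | no v∉H = off-hole-vertex-has-two-neighbours f rep proper H v (curry v∉H)
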